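{- Let $n\ge 11$ and $1\le d\le n-1$ be integers and let $\lambda=(\lambda_1,\dots,\lambda_t)\in\mathbb U^*_{T_{n,d}}$, where $T_{n,d}=\frac{n(n+1)}{2}-d$, be such that $d$ is not a part of $\lambda$. If $\lambda_t=2n-5$, then $d=n-6$, and there is exactly one such partition.
   Context: A partition of $N$ into distinct parts is a sequence of positive integers $\lambda_1<\dots<\lambda_t$ summing to $N$ with $t\ge 2$. Its missing parts are the elements of $\{1,\dots,\lambda_t\}\setminus\{\lambda_1,\dots,\lambda_t\}$. $\lambda$ is refinable if two distinct missing parts sum to a part of $\lambda$, unrefinable otherwise; $\mathbb U_N$ is the set of unrefinable partitions of $N$. $\mathbb U^*_N$ is the set of $\lambda\in\mathbb U_N$ whose largest part is the maximum of the largest parts over all of $\mathbb U_N$. Standing assumption: $n\ge 11$. -}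

module Defs where

open import Data.Nat using (ℕ; _+_; _*_; _∸_; _≤_; _<_; _⊔_)
open import Data.Nat.DivMod using (_/_)
open import Data.List using (List; length; foldr)
open import Data.Nat.ListAction using (sum)
open import Data.List.Relation.Unary.All using (All)
open import Data.List.Relation.Unary.Linked using (Linked)
open import Data.List.Membership.Propositional using (_∈_; _∉_)
open import Data.Product using (_×_; ∃-syntax)
open import Relation.Binary.PropositionalEquality using (_≡_; _≢_)
open import Relation.Nullary using (¬_)

-- A partition is a strictly increasing list λ₁ < … < λₜ of positive integers.
-- largest part λₜ (for strictly increasing lists this is the last entry)
largestPart : List ℕ → ℕ
largestPart = foldr _⊔_ 0

IsDistinctPartition : ℕ → List ℕ → Set
IsDistinctPartition N λs =
  Linked _<_ λs × All (λ x → 1 ≤ x) λs × sum λs ≡ N × 2 ≤ length λs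

IsMissing : List ℕ → ℕ → Set
IsMissing λs m = 1 ≤ m × m ≤ largestPart λs × m ∉ λs

Refinable : List ℕ → Set
Refinable λs = ∃[ a ] ∃[ b ] (a ≢ b × IsMissing λs a × IsMissing λs b × (a + b) ∈ λs)

IsUnrefinable : ℕ → List ℕ → Set
IsUnrefinable N λs = IsDistinctPartition N λs × ¬ Refinable λs

IsMaxUnrefinable : ℕ → List ℕ → Set
IsMaxUnrefinable N λs =
  IsUnrefinable N λs × (∀ μ → IsUnrefinable N μ → largestPart μ ≤ largestPart λs)

T : ℕ → ℕ → ℕ
T n d = (n * (n + 1)) / 2 ∸ d

-- The largest part is L = 2n − 5 = 2k + 1 with k = n − 3.  If a ≤ k and both a and L − a
-- were missing parts, a + (L − a) = L would refine λ; so every pair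
-- {a, L − a} meets λ, the parts below L sum to at least 1 + ⋯ + k, and comparing with
-- |λ| = T_{n,d} the total excess E over this minimum satisfies E + d = n + 2.  Since d is
-- missing, its partner L − d is a part, which costs excess L − 2d and forces d ≥ n − 7.  The
-- value d = n − 7 is ruled out by maximality: T_{n,n−7} has an explicit unrefinable partition
-- with largest part 2n − 4.  With d = n − 6 + i the remaining budget E = 8 − i leaves no
-- excess to the pairs of a ≤ n − 5 other than d, and a case analysis on the pairs of n − 4
-- and n − 3 leaves only i = 0, with the membership of every element of [1, L] determined.
-- Two strictly increasing lists with the same elements coincide.

{-# OPTIONS --safe #-}
module Submission where

open import Algebra.Properties.CommutativeSemigroup as Semigroup using ()
open import Data.Empty using (⊥; ⊥-elim)
open import Data.List using (List; []; _∷_; [_]; _++_; length; applyUpTo)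
open import Data.List.Membership.Propositional using (_∈_; _∉_)
open import Data.List.Membership.Propositional.Properties using (∈-++⁺ˡ; ∈-++⁺ʳ; ∈-++⁻; ∈-applyUpTo⁺; ∈-applyUpTo⁻)
open import Data.List.Properties using (applyUpTo-∷ʳ; length-++-≤ʳ)
open import Data.List.Relation.Binary.Subset.Propositional using (_⊆_)
open import Data.List.Relation.Unary.All as All using (All; []; _∷_)
open import Data.List.Relation.Unary.All.Properties using (applyUpTo⁺₁; applyUpTo⁺₂; ++⁺)
open import Data.List.Relation.Unary.AllPairs using (_∷_)
open import Data.List.Relation.Unary.Any using (here; there)
open import Data.List.Relation.Unary.Linked as Linked using (Linked; []; [-]; _∷_)
open import Data.List.Relation.Unary.Linked.Properties as Linked using (Linked⇒AllPairs)
open import Data.Nat using (ℕ; zero; suc; _+_; _*_; _∸_; _≤_; _<_; z≤n; s≤s; _≟_; _≤?_)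
open import Data.Nat.DivMod using (_/_; m*n/n≡m)
open import Data.Nat.ListAction using (sum)
open import Data.Nat.ListAction.Properties using (sum-++)
open import Data.Nat.Properties
open import Data.Nat.Tactic.RingSolver using (solve-∀)
open import Data.List.Membership.DecPropositional _≟_ using (_∈?_)
open import Data.Product using (_×_; _,_; proj₁; proj₂; ∃-syntax; uncurry)
open import Data.Sum as Sum using (_⊎_; inj₁; inj₂)
open import Function using (id; _∘_)
open import Relation.Binary.PropositionalEquality
  using (_≡_; _≢_; refl; sym; trans; cong; cong₂; subst; ≢-sym; module ≡-Reasoning)
open import Relation.Nullary using (¬_; Dec; yes; no; contradiction)

open Semigroup +-commutativeSemigroup using (interchange; xy∙z≈xz∙y; xy∙z≈zx∙y)

open import Defs

private variable
  f g : ℕ → ℕ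
  a b c i j k x y N : ℕ
  xs ys : List ℕ

sumTo : (ℕ → ℕ) → ℕ → ℕ
sumTo f zero    = 0
sumTo f (suc N) = sumTo f N + f (suc N)

≤∧≢1+n⇒≤n : a ≤ suc N → a ≢ suc N → a ≤ N
≤∧≢1+n⇒≤n a≤ a≢ = m<1+n⇒m≤n (≤∧≢⇒< a≤ a≢)

sumTo-cong : ∀ N → (∀ {a} → 1 ≤ a → a ≤ N → f a ≡ g a) → sumTo f N ≡ sumTo g N
sumTo-cong zero    f≗g = refl
sumTo-cong (suc N) f≗g =
  cong₂ _+_ (sumTo-cong N (λ 1≤a a≤N → f≗g 1≤a (m≤n⇒m≤1+n a≤N))) (f≗g (s≤s z≤n) ≤-refl)

sumTo-zero : ∀ N → (∀ {a} → 1 ≤ a → a ≤ N → f a ≡ 0) → sumTo f N ≡ 0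
sumTo-zero zero    f≗0 = refl
sumTo-zero (suc N) f≗0 =
  cong₂ _+_ (sumTo-zero N (λ 1≤a a≤N → f≗0 1≤a (m≤n⇒m≤1+n a≤N))) (f≗0 (s≤s z≤n) ≤-refl)

sumTo-distrib-+ : ∀ N → sumTo (λ a → f a + g a) N ≡ sumTo f N + sumTo g N
sumTo-distrib-+ zero    = refl
sumTo-distrib-+ {f} {g} (suc N) = trans (cong (_+ (f (suc N) + g (suc N))) (sumTo-distrib-+ N))
  (interchange (sumTo f N) (sumTo g N) (f (suc N)) (g (suc N)))

f≤sumTo : ∀ N → 1 ≤ i → i ≤ N → f i ≤ sumTo f N
f≤sumTo zero (s≤s _) ()
f≤sumTo {i} (suc N) 1≤i i≤ with i ≟ suc N
... | yes refl = m≤n+m _ _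
... | no i≢    = ≤-trans (f≤sumTo N 1≤i (≤∧≢1+n⇒≤n i≤ i≢)) (m≤m+n _ _)

f+f≤sumTo : ∀ N → 1 ≤ i → i ≤ N → 1 ≤ j → j ≤ N → i ≢ j → f i + f j ≤ sumTo f N
f+f≤sumTo zero (s≤s _) ()
f+f≤sumTo {i} {j} {f} (suc N) 1≤i i≤ 1≤j j≤ i≢j with i ≟ suc N | j ≟ suc N
... | yes refl | yes refl = contradiction refl i≢j
... | yes refl | no j≢ = begin
  f i + f j          ≤⟨ +-monoʳ-≤ (f i) (f≤sumTo N 1≤j (≤∧≢1+n⇒≤n j≤ j≢)) ⟩
  f i + sumTo f N    ≡⟨ +-comm (f i) _ ⟩
  sumTo f (suc N)    ∎
  where open ≤-Reasoning
... | no i≢ | yes refl = +-monoˡ-≤ (f j) (f≤sumTo N 1≤i (≤∧≢1+n⇒≤n i≤ i≢))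
... | no i≢ | no j≢ =
  ≤-trans (f+f≤sumTo N 1≤i (≤∧≢1+n⇒≤n i≤ i≢) 1≤j (≤∧≢1+n⇒≤n j≤ j≢) i≢j) (m≤m+n _ _)

sumTo-point : ∀ N → 1 ≤ i → i ≤ N → (∀ {a} → 1 ≤ a → a ≤ N → a ≢ i → f a ≡ 0) →
              sumTo f N ≡ f i
sumTo-point zero (s≤s _) ()
sumTo-point {i} {f} (suc N) 1≤i i≤ f≗0 with i ≟ suc N
... | yes refl = cong (_+ f i) (sumTo-zero N λ 1≤a a≤N →
                   f≗0 1≤a (m≤n⇒m≤1+n a≤N) (λ { refl → 1+n≰n a≤N }))
... | no i≢    = trans (cong₂ _+_ (sumTo-point N 1≤i (≤∧≢1+n⇒≤n i≤ i≢)
                                    λ 1≤a a≤N → f≗0 1≤a (m≤n⇒m≤1+n a≤N))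
                                  (f≗0 (s≤s z≤n) ≤-refl (≢-sym i≢)))
                       (+-identityʳ _)

sumTo-shift : ∀ N → sumTo (λ a → f (suc a)) N + f 1 ≡ sumTo f N + f (suc N)
sumTo-shift         zero    = refl
sumTo-shift {f} (suc N) = trans (xy∙z≈xz∙y (sumTo (λ a → f (suc a)) N) (f (2 + N)) (f 1))
                                (cong (_+ f (2 + N)) (sumTo-shift N))

sumTo-reverse : ∀ N → sumTo (λ a → f (suc N ∸ a)) N ≡ sumTo f N
sumTo-reverse         zero    = refl
sumTo-reverse {f} (suc N) = begin
  sumTo (λ a → f (2 + N ∸ a)) N + f (2 + N ∸ suc N) ≡⟨ cong₂ _+_ reverse-tail (cong f (m+n∸n≡m 1 (suc N))) ⟩
  sumTo (λ a → f (suc a)) N + f 1                   ≡⟨ sumTo-shift N ⟩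
  sumTo f (suc N)                                   ∎
  where
  open ≡-Reasoning
  reverse-tail : sumTo (λ a → f (2 + N ∸ a)) N ≡ sumTo (λ a → f (suc a)) N
  reverse-tail = trans (sumTo-cong N λ _ a≤N → cong f (+-∸-assoc 1 (m≤n⇒m≤1+n a≤N)))
                       (sumTo-reverse N)

sumTo-split : ∀ j N → sumTo f (j + N) ≡ sumTo f j + sumTo (λ a → f (j + a)) N
sumTo-split {f} j zero    = trans (cong (sumTo f) (+-identityʳ j)) (sym (+-identityʳ _))
sumTo-split {f} j (suc N) = begin
  sumTo f (j + suc N)                                         ≡⟨ cong (sumTo f) (+-suc j N) ⟩
  sumTo f (j + N) + f (suc (j + N))                           ≡⟨ cong₂ _+_ (sumTo-split j N) (cong f (sym (+-suc j N))) ⟩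
  sumTo f j + sumTo (λ a → f (j + a)) N + f (j + suc N)       ≡⟨ +-assoc (sumTo f j) _ _ ⟩
  sumTo f j + sumTo (λ a → f (j + a)) (suc N)                 ∎
  where open ≡-Reasoning

sumTo-pairs : ∀ k → sumTo f (k + k) ≡ sumTo (λ a → f a + f (suc (k + k) ∸ a)) k
sumTo-pairs {f} k = begin
  sumTo f (k + k)                                    ≡⟨ sumTo-split k k ⟩
  sumTo f k + sumTo (λ a → f (k + a)) k              ≡⟨ cong (sumTo f k +_) upper-half ⟨
  sumTo f k + sumTo (λ a → f (suc (k + k) ∸ a)) k    ≡⟨ sumTo-distrib-+ k ⟨
  sumTo (λ a → f a + f (suc (k + k) ∸ a)) k          ∎
  where
  open ≡-Reasoning
  upper-half : sumTo (λ a → f (suc (k + k) ∸ a)) k ≡ sumTo (λ a → f (k + a)) k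
  upper-half = trans (sumTo-cong k λ {a} _ a≤k → cong f (begin
                       suc (k + k) ∸ a   ≡⟨ cong (_∸ a) (+-suc k k) ⟨
                       k + suc k ∸ a     ≡⟨ +-∸-assoc k (m≤n⇒m≤1+n a≤k) ⟩
                       k + (suc k ∸ a)   ∎))
                     (sumTo-reverse k)

sumTo-id*2 : ∀ N → sumTo id N * 2 ≡ N * (N + 1)
sumTo-id*2 zero    = refl
sumTo-id*2 (suc N) = begin
  (sumTo id N + suc N) * 2     ≡⟨ *-distribʳ-+ 2 (sumTo id N) (suc N) ⟩
  sumTo id N * 2 + suc N * 2   ≡⟨ cong (_+ suc N * 2) (sumTo-id*2 N) ⟩
  N * (N + 1) + suc N * 2      ≡⟨ identity N ⟩
  suc N * (suc N + 1)          ∎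
  where
  open ≡-Reasoning
  identity : ∀ N → N * (N + 1) + suc N * 2 ≡ suc N * (suc N + 1)
  identity = solve-∀

N[N+1]/2≡sumTo-id : ∀ N → N * (N + 1) / 2 ≡ sumTo id N
N[N+1]/2≡sumTo-id N = trans (cong (_/ 2) (sym (sumTo-id*2 N))) (m*n/n≡m (sumTo id N) 2)

χ : List ℕ → ℕ → ℕ
χ xs y with y ∈? xs
... | yes _ = y
... | no  _ = 0

χ-∈ : ∀ xs → y ∈ xs → χ xs y ≡ y
χ-∈ {y} xs y∈xs with y ∈? xs
... | yes _    = refl
... | no  y∉xs = contradiction y∈xs y∉xs

χ-∉ : ∀ xs → y ∉ xs → χ xs y ≡ 0
χ-∉ {y} xs y∉xs with y ∈? xs
... | yes y∈xs = contradiction y∈xs y∉xs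
... | no  _    = refl

∉-∷ : y ≢ x → y ∉ xs → y ∉ x ∷ xs
∉-∷ y≢x _    (here y≡x)  = y≢x y≡x
∉-∷ _   y∉xs (there y∈xs) = y∉xs y∈xs

χ-∷ : x ∉ xs → χ (x ∷ xs) y ≡ χ [ x ] y + χ xs y
χ-∷ {x} {xs} {y} x∉xs = by-cases (y ≟ x) (y ∈? xs)
  where
  by-cases : Dec (y ≡ x) → Dec (y ∈ xs) → χ (x ∷ xs) y ≡ χ [ x ] y + χ xs y
  by-cases (yes refl) _          = trans (χ-∈ (x ∷ xs) (here refl))
    (sym (trans (cong₂ _+_ (χ-∈ [ x ] (here refl)) (χ-∉ xs x∉xs)) (+-identityʳ x)))
  by-cases (no y≢x)   (yes y∈xs) =
    trans (χ-∈ (x ∷ xs) (there y∈xs)) (sym (cong₂ _+_ (χ-∉ [ x ] (∉-∷ y≢x λ ())) (χ-∈ xs y∈xs)))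
  by-cases (no y≢x)   (no y∉xs)  =
    trans (χ-∉ (x ∷ xs) (∉-∷ y≢x y∉xs)) (sym (cong₂ _+_ (χ-∉ [ x ] (∉-∷ y≢x λ ())) (χ-∉ xs y∉xs)))

head<tail : Linked _<_ (x ∷ xs) → All (x <_) xs
head<tail sorted with Linked⇒AllPairs <-trans sorted
... | x<xs ∷ _ = x<xs

sorted-head∉tail : Linked _<_ (x ∷ xs) → x ∉ xs
sorted-head∉tail sorted x∈xs = <-irrefl refl (All.lookup (head<tail sorted) x∈xs)

sumTo-χ-singleton : ∀ N → 1 ≤ x → x ≤ N → sumTo (χ [ x ]) N ≡ x
sumTo-χ-singleton {x} N 1≤x x≤N =
  trans (sumTo-point N 1≤x x≤N λ _ _ a≢x → χ-∉ [ x ] λ { (here a≡x) → a≢x a≡x }) (χ-∈ [ x ] (here refl))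

sum≡sumTo-χ : ∀ N → Linked _<_ xs → All (1 ≤_) xs → All (_≤ N) xs → sum xs ≡ sumTo (χ xs) N
sum≡sumTo-χ {[]}     N _      _              _              = sym (sumTo-zero N λ {a} _ _ → χ-∉ {a} [] λ ())
sum≡sumTo-χ {x ∷ xs} N sorted (1≤x ∷ 1≤xs) (x≤N ∷ xs≤N) = begin
  x + sum xs                                ≡⟨ cong (x +_) (sum≡sumTo-χ N (Linked.tail sorted) 1≤xs xs≤N) ⟩
  x + sumTo (χ xs) N                        ≡⟨ cong (_+ sumTo (χ xs) N) (sumTo-χ-singleton N 1≤x x≤N) ⟨
  sumTo (χ [ x ]) N + sumTo (χ xs) N        ≡⟨ sumTo-distrib-+ N ⟨
  sumTo (λ y → χ [ x ] y + χ xs y) N        ≡⟨ sumTo-cong N (λ _ _ → χ-∷ (sorted-head∉tail sorted)) ⟨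
  sumTo (χ (x ∷ xs)) N                      ∎
  where open ≡-Reasoning

sorted-⊆-tail : Linked _<_ (x ∷ xs) → x ∷ xs ⊆ x ∷ ys → xs ⊆ ys
sorted-⊆-tail sorted ⊆ z∈xs with ⊆ (there z∈xs)
... | here refl  = contradiction (All.lookup (head<tail sorted) z∈xs) (<-irrefl refl)
... | there z∈ys = z∈ys

sorted-⊆-antisym : Linked _<_ xs → Linked _<_ ys → xs ⊆ ys → ys ⊆ xs → xs ≡ ys
sorted-⊆-antisym {[]}     {[]}     _  _  _    _    = refl
sorted-⊆-antisym {[]}     {y ∷ ys} _  _  _    ys⊆ with () ← ys⊆ (here refl)
sorted-⊆-antisym {x ∷ xs} {[]}     _  _  xs⊆ _    with () ← xs⊆ (here refl)
sorted-⊆-antisym {x ∷ xs} {y ∷ ys} sx sy xs⊆ ys⊆ with xs⊆ (here refl) | ys⊆ (here refl)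
... | here refl  | _         = cong (x ∷_) (sorted-⊆-antisym (Linked.tail sx) (Linked.tail sy)
                                 (sorted-⊆-tail sx xs⊆) (sorted-⊆-tail sy ys⊆))
... | there _    | here refl = cong (x ∷_) (sorted-⊆-antisym (Linked.tail sx) (Linked.tail sy)
                                 (sorted-⊆-tail sx xs⊆) (sorted-⊆-tail sy ys⊆))
... | there x∈ys | there y∈xs =
  contradiction (All.lookup (head<tail sy) x∈ys) (<-asym (All.lookup (head<tail sx) y∈xs))

∈⇒≤largestPart : x ∈ xs → x ≤ largestPart xs
∈⇒≤largestPart {xs = y ∷ xs} (here refl)  = m≤m⊔n y (largestPart xs)
∈⇒≤largestPart {xs = y ∷ xs} (there x∈xs) = ≤-trans (∈⇒≤largestPart x∈xs) (m≤n⊔m y (largestPart xs))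

largestPart∈ : largestPart (x ∷ xs) ∈ x ∷ xs
largestPart∈ {x} {[]}     = here (⊔-identityʳ x)
largestPart∈ {x} {y ∷ xs} with ⊔-sel x (largestPart (y ∷ xs))
... | inj₁ x⊔≡x = here x⊔≡x
... | inj₂ x⊔≡  = there (subst (_∈ y ∷ xs) (sym x⊔≡) largestPart∈)

largestPart∈-nonempty : 1 ≤ length xs → largestPart xs ∈ xs
largestPart∈-nonempty {x ∷ xs} _ = largestPart∈

sum-applyUpTo-suc : ∀ c → sum (applyUpTo suc c) ≡ sumTo id c
sum-applyUpTo-suc zero    = refl
sum-applyUpTo-suc (suc c) = begin
  sum (applyUpTo suc (suc c))          ≡⟨ cong sum (applyUpTo-∷ʳ suc c) ⟨
  sum (applyUpTo suc c ++ [ suc c ])   ≡⟨ sum-++ (applyUpTo suc c) [ suc c ] ⟩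
  sum (applyUpTo suc c) + (suc c + 0)  ≡⟨ cong₂ _+_ (sum-applyUpTo-suc c) (+-identityʳ (suc c)) ⟩
  sumTo id c + suc c                   ∎
  where open ≡-Reasoning

∈-applyUpTo-suc : ∀ {c} → 1 ≤ x → x ≤ c → x ∈ applyUpTo suc c
∈-applyUpTo-suc (s≤s z≤n) x≤c = ∈-applyUpTo⁺ suc x≤c

linked-++ : Linked _<_ xs → All (_< y) xs → Linked _<_ (y ∷ ys) → Linked _<_ (xs ++ y ∷ ys)
linked-++ []                 []             sorted = sorted
linked-++ [-]                (x<y ∷ [])     sorted = x<y ∷ sorted
linked-++ (x<x′ ∷ xs-sorted) (_ ∷ xs<y)     sorted = x<x′ ∷ linked-++ xs-sorted xs<y sorted

+≡double⇒≡ : x + y ≡ a + a → a ≤ x → a ≤ y → x ≡ a × y ≡ a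
+≡double⇒≡ {x} {y} {a} x+y≡2a a≤x a≤y =
  ≤-antisym (+-cancelʳ-≤ a x a (≤-trans (+-monoʳ-≤ x a≤y) (≤-reflexive x+y≡2a))) a≤x ,
  ≤-antisym (+-cancelˡ-≤ a y a (≤-trans (+-monoˡ-≤ y a≤x) (≤-reflexive x+y≡2a))) a≤y

partner-≡ : a + x ≡ N → a + y ≡ N → x ≡ y
partner-≡ a+x≡N a+y≡N = +-cancelˡ-≡ _ _ _ (trans a+x≡N (sym a+y≡N))

⊆-by-pairs : ∀ k → (∀ {x} → x ∈ xs → 1 ≤ x × x ≤ suc (k + k)) → suc (k + k) ∈ ys →
             (∀ {a b} → 1 ≤ a → a ≤ k → a + b ≡ suc (k + k) → (a ∈ xs → a ∈ ys) × (b ∈ xs → b ∈ ys)) →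
             xs ⊆ ys
⊆-by-pairs {xs} {ys} k bounds L∈ys pairs {x} x∈xs with x ≤? k | x ≟ suc (k + k)
... | yes x≤k | _        = proj₁ (pairs (proj₁ (bounds x∈xs)) x≤k (m+[n∸m]≡n x≤L)) x∈xs
  where x≤L = proj₂ (bounds x∈xs)
... | no  _   | yes refl = L∈ys
... | no  x≰k | no  x≢L  = proj₂ (pairs 1≤a a≤k (m∸n+n≡m x≤L)) x∈xs
  where
  x≤L = proj₂ (bounds x∈xs)
  1≤a : 1 ≤ suc (k + k) ∸ x
  1≤a = m<n⇒0<n∸m (≤∧≢⇒< x≤L x≢L)
  a≤k : suc (k + k) ∸ x ≤ k
  a≤k = begin
    suc (k + k) ∸ x      ≤⟨ ∸-monoʳ-≤ (suc (k + k)) (≰⇒> x≰k) ⟩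
    suc (k + k) ∸ suc k  ≡⟨ m+n∸n≡m k k ⟩
    k                    ∎
    where open ≤-Reasoning

module OddLargestPart {N k : ℕ} {λs : List ℕ} (λs∈𝕌 : IsUnrefinable N λs)
                      (largest : largestPart λs ≡ suc (k + k)) where

  L : ℕ
  L = suc (k + k)

  private
    sorted : Linked _<_ λs
    sorted = proj₁ (proj₁ λs∈𝕌)
    positive : All (1 ≤_) λs
    positive = proj₁ (proj₂ (proj₁ λs∈𝕌))
    unrefinable : ¬ Refinable λs
    unrefinable = proj₂ λs∈𝕌

  L∈λs : L ∈ λs
  L∈λs = subst (_∈ λs) largest
                (largestPart∈-nonempty (≤-trans (n≤1+n 1) (proj₂ (proj₂ (proj₂ (proj₁ λs∈𝕌))))))

  bounds : x ∈ λs → 1 ≤ x × x ≤ L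
  bounds x∈λs = All.lookup positive x∈λs , subst (_ ≤_) largest (∈⇒≤largestPart x∈λs)

  <-partner : a ≤ k → a + b ≡ L → a < b
  <-partner {a} {b} a≤k a+b≡L = ≰⇒> λ b≤a → 1+n≰n (begin
    L      ≡⟨ a+b≡L ⟨
    a + b  ≤⟨ +-mono-≤ a≤k (≤-trans b≤a a≤k) ⟩
    k + k  ∎)
    where open ≤-Reasoning

  a+[L∸a]≡L : a ≤ k → a + (L ∸ a) ≡ L
  a+[L∸a]≡L a≤k = m+[n∸m]≡n (≤-trans a≤k (≤-trans (m≤m+n k k) (n≤1+n _)))

  covered : 1 ≤ a → a ≤ k → a + b ≡ L → a ∈ λs ⊎ b ∈ λs
  covered {a} {b} 1≤a a≤k a+b≡L with a ∈? λs | b ∈? λs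
  ... | yes a∈λs | _        = inj₁ a∈λs
  ... | no  _    | yes b∈λs = inj₂ b∈λs
  ... | no  a∉λs | no  b∉λs = contradiction refinable unrefinable
    where
    a<b = <-partner a≤k a+b≡L
    missing : ∀ {x} → 1 ≤ x → x ≤ L → x ∉ λs → IsMissing λs x
    missing 1≤x x≤L x∉λs = 1≤x , subst (_ ≤_) (sym largest) x≤L , x∉λs
    refinable : Refinable λs
    refinable = a , b , <⇒≢ a<b
              , missing 1≤a (subst (a ≤_) a+b≡L (m≤m+n a b)) a∉λs
              , missing (≤-trans 1≤a (<⇒≤ a<b)) (subst (b ≤_) a+b≡L (m≤n+m b a)) b∉λs
              , subst (_∈ λs) (sym a+b≡L) L∈λs

  excess : ℕ → ℕ
  excess a = χ λs a + χ λs (L ∸ a) ∸ a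

  excess-by : ∀ {u v} → a + b ≡ L → χ λs a ≡ u → χ λs b ≡ v → excess a ≡ u + v ∸ a
  excess-by {a} {b} a+b≡L refl refl =
    cong (λ c → χ λs a + χ λs c ∸ a) (trans (cong (_∸ a) (sym a+b≡L)) (m+n∸m≡n a b))

  data PairKind (a b : ℕ) : Set where
    lower : a ∈ λs → b ∉ λs → excess a ≡ 0         → PairKind a b
    upper : a ∉ λs → b ∈ λs → a + a + excess a ≡ L → PairKind a b
    both  : a ∈ λs → b ∈ λs → a + excess a ≡ L     → PairKind a b

  pairKind : 1 ≤ a → a ≤ k → a + b ≡ L → PairKind a b
  pairKind {a} {b} 1≤a a≤k a+b≡L with a ∈? λs | b ∈? λs
  ... | yes a∈λs | no b∉λs  =
    lower a∈λs b∉λs (trans (excess-by a+b≡L (χ-∈ λs a∈λs) (χ-∉ λs b∉λs)) (m+n∸m≡n a 0))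
  ... | no a∉λs  | yes b∈λs = upper a∉λs b∈λs (begin
    a + a + excess a    ≡⟨ cong (a + a +_) (excess-by a+b≡L (χ-∉ λs a∉λs) (χ-∈ λs b∈λs)) ⟩
    a + a + (b ∸ a)     ≡⟨ +-assoc a a (b ∸ a) ⟩
    a + (a + (b ∸ a))   ≡⟨ cong (a +_) (m+[n∸m]≡n (<⇒≤ (<-partner a≤k a+b≡L))) ⟩
    a + b               ≡⟨ a+b≡L ⟩
    L                   ∎)
    where open ≡-Reasoning
  ... | yes a∈λs | yes b∈λs = both a∈λs b∈λs (begin
    a + excess a        ≡⟨ cong (a +_) (excess-by a+b≡L (χ-∈ λs a∈λs) (χ-∈ λs b∈λs)) ⟩
    a + (a + b ∸ a)     ≡⟨ cong (a +_) (m+n∸m≡n a b) ⟩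
    a + b               ≡⟨ a+b≡L ⟩
    L                   ∎)
    where open ≡-Reasoning
  ... | no a∉λs  | no b∉λs  with covered 1≤a a≤k a+b≡L
  ...   | inj₁ a∈λs = contradiction a∈λs a∉λs
  ...   | inj₂ b∈λs = contradiction b∈λs b∉λs

  missing⇒upper : 1 ≤ a → a ≤ k → a + b ≡ L → a ∉ λs → b ∈ λs × a + a + excess a ≡ L
  missing⇒upper 1≤a a≤k a+b≡L a∉λs with pairKind 1≤a a≤k a+b≡L
  ... | lower a∈λs _ _        = contradiction a∈λs a∉λs
  ... | upper _ b∈λs a+a+e≡L  = b∈λs , a+a+e≡L
  ... | both  a∈λs _ _        = contradiction a∈λs a∉λs

  sum≡sumTo-id+excess : sum λs ≡ sumTo id k + sumTo excess k + L
  sum≡sumTo-id+excess = begin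
    sum λs                                      ≡⟨ sum≡sumTo-χ L sorted positive (All.tabulate (proj₂ ∘ bounds)) ⟩
    sumTo (χ λs) (k + k) + χ λs L               ≡⟨ cong₂ _+_ (sumTo-pairs k) (χ-∈ λs L∈λs) ⟩
    sumTo (λ a → χ λs a + χ λs (L ∸ a)) k + L   ≡⟨ cong (_+ L) (sumTo-cong k pair≡) ⟨
    sumTo (λ a → a + excess a) k + L            ≡⟨ cong (_+ L) (sumTo-distrib-+ k) ⟩
    sumTo id k + sumTo excess k + L             ∎
    where
    open ≡-Reasoning
    a≤pair : 1 ≤ a → a ≤ k → a ≤ χ λs a + χ λs (L ∸ a)
    a≤pair {a} 1≤a a≤k with covered 1≤a a≤k (a+[L∸a]≡L a≤k)
    ... | inj₁ a∈λs = ≤-trans (≤-reflexive (sym (χ-∈ λs a∈λs))) (m≤m+n (χ λs a) (χ λs (L ∸ a)))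
    ... | inj₂ b∈λs = subst (a ≤_) (cong (χ λs a +_) (sym (χ-∈ λs b∈λs)))
                        (≤-trans (<⇒≤ (<-partner a≤k (a+[L∸a]≡L a≤k))) (m≤n+m _ _))
    pair≡ : 1 ≤ a → a ≤ k → a + excess a ≡ χ λs a + χ λs (L ∸ a)
    pair≡ 1≤a a≤k = m+[n∸m]≡n (a≤pair 1≤a a≤k)

≤-of-+≡ : x + y ≡ a + b → x ≤ a → b ≤ y
≤-of-+≡ {x} {y} {a} {b} x+y≡a+b x≤a =
  +-cancelˡ-≤ a b y (≤-trans (≤-reflexive (sym x+y≡a+b)) (+-monoˡ-≤ y x≤a))

2*[11+m]∸5 : ∀ m → 2 * (11 + m) ∸ 5 ≡ suc ((8 + m) + (8 + m))
2*[11+m]∸5 m = trans (cong (_∸ 5) (regroup m)) (m+n∸m≡n 5 _)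
  where
  regroup : ∀ m → 2 * (11 + m) ≡ 5 + suc ((8 + m) + (8 + m))
  regroup = solve-∀

17+2m : ∀ m → 17 + (m + m) ≡ suc ((8 + m) + (8 + m))
17+2m = solve-∀

partners : ∀ {m} c c′ → c + c′ ≡ 17 → (c + m) + (c′ + m) ≡ suc ((8 + m) + (8 + m))
partners {m} c c′ c+c′≡17 = begin
  (c + m) + (c′ + m)        ≡⟨ regroup c c′ m ⟩
  (c + c′) + (m + m)        ≡⟨ cong (_+ (m + m)) c+c′≡17 ⟩
  17 + (m + m)              ≡⟨ 17+2m m ⟩
  suc ((8 + m) + (8 + m))   ∎
  where
  open ≡-Reasoning
  regroup : ∀ c c′ m → (c + m) + (c′ + m) ≡ (c + c′) + (m + m)
  regroup = solve-∀

double : ∀ {m} c → (c + m) + (c + m) + x ≡ suc ((8 + m) + (8 + m)) → c + c + x ≡ 17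
double {x} {m} c 2[c+m]+x≡L = +-cancelʳ-≡ (m + m) (c + c + x) 17 (begin
  c + c + x + (m + m)       ≡⟨ regroup c x m ⟩
  (c + m) + (c + m) + x     ≡⟨ 2[c+m]+x≡L ⟩
  suc ((8 + m) + (8 + m))   ≡⟨ 17+2m m ⟨
  17 + (m + m)              ∎)
  where
  open ≡-Reasoning
  regroup : ∀ c x m → c + c + x + (m + m) ≡ (c + m) + (c + m) + x
  regroup = solve-∀

-- [1, n − 7] ∪ {n − 5, n − 4, n − 3, n + 2, 2n − 4} with n = 11 + m.
module Witness (m : ℕ) where

  segment : List ℕ
  segment = applyUpTo suc (4 + m)

  upper-parts : List ℕ
  upper-parts = 6 + m ∷ 7 + m ∷ 8 + m ∷ 13 + m ∷ 18 + (m + m) ∷ []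

  partition : List ℕ
  partition = segment ++ upper-parts

  private
    upper-parts∈ : x ∈ upper-parts → x ∈ partition
    upper-parts∈ = ∈-++⁺ʳ segment

  sorted : Linked _<_ partition
  sorted = linked-++ (Linked.applyUpTo⁺₂ suc (4 + m) λ _ → ≤-refl)
                     (applyUpTo⁺₁ suc (4 + m) λ i<4+m → m≤n⇒m≤1+n (s≤s i<4+m))
                     (≤-refl ∷ ≤-refl ∷ m≤n+m (9 + m) 4 ∷ m+n≤o⇒m≤o (14 + m) (≤-reflexive (regroup m)) ∷ [-])
    where
    regroup : ∀ m → 14 + m + (4 + m) ≡ 18 + (m + m)
    regroup = solve-∀

  members : x ∈ partition → x ≤ 13 + m ⊎ x ≡ 18 + (m + m)
  members x∈parts with ∈-++⁻ segment x∈parts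
  ... | inj₁ x∈segment with _ , i<4+m , refl ← ∈-applyUpTo⁻ suc x∈segment =
    inj₁ (≤-trans i<4+m (m≤n+m (4 + m) 9))
  ... | inj₂ (here refl)                             = inj₁ (m≤n+m (6 + m) 7)
  ... | inj₂ (there (here refl))                     = inj₁ (m≤n+m (7 + m) 6)
  ... | inj₂ (there (there (here refl)))             = inj₁ (m≤n+m (8 + m) 5)
  ... | inj₂ (there (there (there (here refl))))     = inj₁ ≤-refl
  ... | inj₂ (there (there (there (there (here refl))))) = inj₂ refl

  missing : 1 ≤ x → x ∉ partition → x ≡ 5 + m ⊎ (9 + m ≤ x × x ≢ 13 + m)
  missing {x} 1≤x x∉parts with x ≤? 4 + m | x ≟ 5 + m
  ... | yes x≤4+m | _         = contradiction (∈-++⁺ˡ (∈-applyUpTo-suc 1≤x x≤4+m)) x∉parts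
  ... | no  _     | yes x≡5+m = inj₁ x≡5+m
  ... | no  x≰4+m | no  x≢5+m =
    inj₂ ( past (past (past (≤∧≢⇒< (≰⇒> x≰4+m) (≢-sym x≢5+m)) (here refl))
                      (there (here refl)))
                (there (there (here refl)))
         , λ x≡13+m → x∉parts (upper-parts∈ (there (there (there (here (x≡13+m)))))))
    where
    past : ∀ {y} → y ≤ x → y ∈ upper-parts → suc y ≤ x
    past y≤x y∈upper = ≤∧≢⇒< y≤x λ { refl → x∉parts (upper-parts∈ y∈upper) }

  sum≡T : sum partition ≡ T (11 + m) (4 + m)
  sum≡T = begin
    sum partition                                           ≡⟨ sum-++ segment upper-parts ⟩
    sum segment + sum upper-parts                           ≡⟨ cong (_+ sum upper-parts) (sum-applyUpTo-suc (4 + m)) ⟩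
    sumTo id (4 + m) + sum upper-parts                      ≡⟨ m+n∸n≡m _ (4 + m) ⟨
    sumTo id (4 + m) + sum upper-parts + (4 + m) ∸ (4 + m)  ≡⟨ cong (_∸ (4 + m)) (regroup (sumTo id (4 + m)) m) ⟩
    sumTo id (11 + m) ∸ (4 + m)                             ≡⟨ cong (_∸ (4 + m)) (N[N+1]/2≡sumTo-id (11 + m)) ⟨
    T (11 + m) (4 + m)                                      ∎
    where
    open ≡-Reasoning
    regroup : ∀ t m → t + (6 + m + (7 + m + (8 + m + (13 + m + (18 + (m + m) + 0))))) + (4 + m)
                    ≡ t + (5 + m) + (6 + m) + (7 + m) + (8 + m) + (9 + m) + (10 + m) + (11 + m)
    regroup = solve-∀

  private
    Missing : ℕ → Set
    Missing x = x ≡ 5 + m ⊎ (9 + m ≤ x × x ≢ 13 + m)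

    14+m≤ : 14 + m ≤ (5 + m) + (9 + m)
    14+m≤ = m+n≤o⇒m≤o (14 + m) (≤-reflexive (regroup m))
      where
      regroup : ∀ m → 14 + m + m ≡ (5 + m) + (9 + m)
      regroup = solve-∀

    5+m+big∉ : 9 + m ≤ b × b ≢ 13 + m → (5 + m) + b ≤ 13 + m ⊎ (5 + m) + b ≡ 18 + (m + m) → ⊥
    5+m+big∉ (9+m≤b , _) (inj₁ 5+m+b≤13+m) =
      1+n≰n (≤-trans 14+m≤ (≤-trans (+-monoʳ-≤ (5 + m) 9+m≤b) 5+m+b≤13+m))
    5+m+big∉ (_ , b≢13+m) (inj₂ 5+m+b≡18+2m) = b≢13+m (partner-≡ 5+m+b≡18+2m (regroup m))
      where
      regroup : ∀ m → (5 + m) + (13 + m) ≡ 18 + (m + m)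
      regroup = solve-∀

    missing-sum∉ : a ≢ b → Missing a → Missing b → a + b ≤ 13 + m ⊎ a + b ≡ 18 + (m + m) → ⊥
    missing-sum∉ a≢b (inj₁ refl) (inj₁ refl)   _     = a≢b refl
    missing-sum∉ _   (inj₁ refl) (inj₂ b-big)  a+b∈ = 5+m+big∉ b-big a+b∈
    missing-sum∉ {a} _ (inj₂ a-big) (inj₁ refl)  a+b∈ =
      5+m+big∉ a-big (Sum.map (subst (_≤ 13 + m) (+-comm a _)) (trans (+-comm _ a)) a+b∈)
    missing-sum∉ a≢b (inj₂ (9+m≤a , _)) (inj₂ (9+m≤b , _)) (inj₁ a+b≤13+m) =
      1+n≰n (≤-trans 14+m≤ (≤-trans (+-monoˡ-≤ (9 + m) (m≤n+m (5 + m) 4))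
                                    (≤-trans (+-mono-≤ 9+m≤a 9+m≤b) a+b≤13+m)))
    missing-sum∉ a≢b (inj₂ (9+m≤a , _)) (inj₂ (9+m≤b , _)) (inj₂ a+b≡18+2m) =
      a≢b (trans a≡9+m (sym b≡9+m))
      where
      regroup : ∀ m → 18 + (m + m) ≡ (9 + m) + (9 + m)
      regroup = solve-∀
      a≡9+m = proj₁ (+≡double⇒≡ (trans a+b≡18+2m (regroup m)) 9+m≤a 9+m≤b)
      b≡9+m = proj₂ (+≡double⇒≡ (trans a+b≡18+2m (regroup m)) 9+m≤a 9+m≤b)

  unrefinable : IsUnrefinable (T (11 + m) (4 + m)) partition
  unrefinable = (sorted , positive , sum≡T , length≥2) , not-refinable
    where
    positive : All (1 ≤_) partition
    positive = ++⁺ (applyUpTo⁺₂ suc (4 + m) λ _ → s≤s z≤n)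
                   (s≤s z≤n ∷ s≤s z≤n ∷ s≤s z≤n ∷ s≤s z≤n ∷ s≤s z≤n ∷ [])
    length≥2 : 2 ≤ length partition
    length≥2 = ≤-trans (m≤n+m 2 3) (length-++-≤ʳ upper-parts {segment})
    not-refinable : ¬ Refinable partition
    not-refinable (a , b , a≢b , (1≤a , _ , a∉parts) , (1≤b , _ , b∉parts) , a+b∈parts) =
      missing-sum∉ a≢b (missing 1≤a a∉parts) (missing 1≤b b∉parts) (members a+b∈parts)

  largest : 18 + (m + m) ≤ largestPart partition
  largest = ∈⇒≤largestPart (upper-parts∈ (there (there (there (there (here refl))))))

record Shape (m : ℕ) (xs : List ℕ) : Set where
  field
    lower-pairs : 1 ≤ a → a ≤ 6 + m → a ≢ 5 + m → a + b ≡ suc ((8 + m) + (8 + m)) → a ∈ xs × b ∉ xs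
    5+m∉  : 5 + m ∉ xs
    12+m∈ : 12 + m ∈ xs
    7+m∈  : 7 + m ∈ xs
    10+m∉ : 10 + m ∉ xs
    8+m∉  : 8 + m ∉ xs
    9+m∈  : 9 + m ∈ xs

Shape-⊆ : ∀ {m} → Shape m xs → Shape m ys → 1 ≤ a → a ≤ 8 + m → a + b ≡ suc ((8 + m) + (8 + m)) →
          (a ∈ xs → a ∈ ys) × (b ∈ xs → b ∈ ys)
Shape-⊆ {xs} {ys} {a} {m = m} xs-shape ys-shape 1≤a a≤8+m a+b≡L with a ≤? 6 + m | a ≟ 5 + m
... | yes _     | yes refl =
  (λ a∈xs → contradiction a∈xs (Shape.5+m∉ xs-shape)) ,
  (λ _ → subst (_∈ ys) (partner-≡ (partners 5 12 refl) a+b≡L) (Shape.12+m∈ ys-shape))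
... | yes a≤6+m | no a≢5+m =
  (λ _ → proj₁ (Shape.lower-pairs ys-shape 1≤a a≤6+m a≢5+m a+b≡L)) ,
  (λ b∈xs → contradiction b∈xs (proj₂ (Shape.lower-pairs xs-shape 1≤a a≤6+m a≢5+m a+b≡L)))
... | no a≰6+m  | _ with a ≟ 7 + m
...   | yes refl =
  (λ _ → Shape.7+m∈ ys-shape) ,
  (λ b∈xs → contradiction (subst (_∈ xs) (partner-≡ a+b≡L (partners 7 10 refl)) b∈xs) (Shape.10+m∉ xs-shape))
...   | no a≢7+m with refl ← ≤-antisym a≤8+m (≤∧≢⇒< (≰⇒> a≰6+m) (≢-sym a≢7+m)) =
  (λ a∈xs → contradiction a∈xs (Shape.8+m∉ xs-shape)) ,
  (λ _ → subst (_∈ ys) (partner-≡ (partners 8 9 refl) a+b≡L) (Shape.9+m∈ ys-shape))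

Shape-unique : ∀ {m N N′} → IsUnrefinable N xs → largestPart xs ≡ suc ((8 + m) + (8 + m)) → Shape m xs →
               IsUnrefinable N′ ys → largestPart ys ≡ suc ((8 + m) + (8 + m)) → Shape m ys → xs ≡ ys
Shape-unique {m = m} xs∈𝕌 xs-largest xs-shape ys∈𝕌 ys-largest ys-shape =
  sorted-⊆-antisym (proj₁ (proj₁ xs∈𝕌)) (proj₁ (proj₁ ys∈𝕌))
    (⊆-by-pairs (8 + m) X.bounds Y.L∈λs (Shape-⊆ xs-shape ys-shape))
    (⊆-by-pairs (8 + m) Y.bounds X.L∈λs (Shape-⊆ ys-shape xs-shape))
  where
  module X = OddLargestPart {k = 8 + m} xs∈𝕌 xs-largest
  module Y = OddLargestPart {k = 8 + m} ys∈𝕌 ys-largest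

-- n = 11 + m, k = n − 3 = 8 + m and L = 2n − 5.
module Analysis {m d : ℕ} {λs : List ℕ}
                (λs∈𝕌* : IsMaxUnrefinable (T (11 + m) d) λs)
                (largest : largestPart λs ≡ suc ((8 + m) + (8 + m)))
                (d∉λs : d ∉ λs) (1≤d : 1 ≤ d) (d≤10+m : d ≤ 10 + m) where

  open OddLargestPart {k = 8 + m} (proj₁ λs∈𝕌*) largest

  E : ℕ
  E = sumTo excess (8 + m)

  E+d≡13+m : E + d ≡ 13 + m
  E+d≡13+m = +-cancelˡ-≡ (t + L) (E + d) (13 + m) (begin
    t + L + (E + d)                 ≡⟨ regroup t L E d ⟩
    t + E + L + d                   ≡⟨ cong (_+ d) sum≡sumTo-id+excess ⟨
    sum λs + d                      ≡⟨ cong (_+ d) (trans sum≡T (cong (_∸ d) (N[N+1]/2≡sumTo-id (11 + m)))) ⟩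
    sumTo id (11 + m) ∸ d + d       ≡⟨ m∸n+n≡m (≤-trans d≤10+m (≤-trans (n≤1+n _) (m≤n+m (11 + m) _))) ⟩
    sumTo id (11 + m)               ≡⟨ regroup′ t m ⟩
    t + L + (13 + m)                ∎)
    where
    open ≡-Reasoning
    t = sumTo id (8 + m)
    sum≡T : sum λs ≡ T (11 + m) d
    sum≡T = proj₁ (proj₂ (proj₂ (proj₁ (proj₁ λs∈𝕌*))))
    regroup : ∀ t L e d → t + L + (e + d) ≡ t + e + L + d
    regroup = solve-∀
    regroup′ : ∀ t m → t + (9 + m) + (10 + m) + (11 + m) ≡ t + suc ((8 + m) + (8 + m)) + (13 + m)
    regroup′ = solve-∀

  excess-d : d ≡ c + m → c ≤ 8 → c + c + excess d ≡ 17
  excess-d {c} refl c≤8 =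
    double c (proj₂ (missing⇒upper 1≤d (+-monoˡ-≤ m c≤8) (a+[L∸a]≡L (+-monoˡ-≤ m c≤8)) d∉λs))

  d≢11+m+ : ∀ c → d ≢ c + (11 + m)
  d≢11+m+ c d≡ = 1+n≰n (≤-trans (m≤n+m (11 + m) c) (subst (_≤ 10 + m) d≡ d≤10+m))

  4+m≤d : 4 + m ≤ d
  4+m≤d with d ≤? 8 + m
  ... | no  d≰8+m = ≤-trans (m≤n+m (4 + m) 5) (≰⇒> d≰8+m)
  ... | yes d≤8+m = +-cancelˡ-≤ (13 + m) (4 + m) d (begin
    13 + m + (4 + m)    ≡⟨ partners 13 4 refl ⟩
    L                   ≡⟨ proj₂ (missing⇒upper 1≤d d≤8+m (a+[L∸a]≡L d≤8+m) d∉λs) ⟨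
    d + d + excess d    ≤⟨ +-monoʳ-≤ (d + d) (f≤sumTo (8 + m) 1≤d d≤8+m) ⟩
    d + d + E           ≡⟨ xy∙z≈zx∙y d d E ⟩
    E + d + d           ≡⟨ cong (_+ d) E+d≡13+m ⟩
    13 + m + d          ∎)
    where open ≤-Reasoning

  d≢4+m : d ≢ 4 + m
  d≢4+m d≡4+m = 1+n≰n (begin
    suc L                               ≡⟨ cong suc (17+2m m) ⟨
    18 + (m + m)                        ≤⟨ Witness.largest m ⟩
    largestPart (Witness.partition m)   ≤⟨ proj₂ λs∈𝕌* (Witness.partition m) witness∈𝕌 ⟩
    largestPart λs                      ≡⟨ largest ⟩
    L                                   ∎)
    where
    open ≤-Reasoning
    witness∈𝕌 : IsUnrefinable (T (11 + m) d) (Witness.partition m)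
    witness∈𝕌 = subst (λ d → IsUnrefinable (T (11 + m) d) (Witness.partition m)) (sym d≡4+m)
                      (Witness.unrefinable m)

  d-decomposition : ∃[ i ] d ≡ i + (5 + m)
  d-decomposition = d ∸ (5 + m) , sym (m∸n+n≡m (≤∧≢⇒< 4+m≤d (≢-sym d≢4+m)))

  LowerOrUpper : ℕ → ℕ → ℕ → Set
  LowerOrUpper a b e = (a ∈ λs × b ∉ λs × excess a ≡ 0) ⊎ (a ∉ λs × b ∈ λs × excess a ≡ e)

  module AtOffset (i : ℕ) (d≡ : d ≡ i + (5 + m)) where

    E+i≡8 : E + i ≡ 8
    E+i≡8 = +-cancelʳ-≡ (5 + m) (E + i) 8 (begin
      E + i + (5 + m)     ≡⟨ +-assoc E i (5 + m) ⟩
      E + (i + (5 + m))   ≡⟨ cong (E +_) d≡ ⟨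
      E + d               ≡⟨ E+d≡13+m ⟩
      13 + m              ∎)
      where open ≡-Reasoning

    excess≤8 : 1 ≤ a → a ≤ 8 + m → excess a ≤ 8
    excess≤8 {a} 1≤a a≤8+m = ≤-trans (f≤sumTo (8 + m) 1≤a a≤8+m) (subst (E ≤_) E+i≡8 (m≤m+n E i))

    lower-or-upper : 1 ≤ a → a ≤ 8 + m → a + b ≡ L →
                     (a ∈ λs × b ∉ λs × excess a ≡ 0) ⊎ (a ∉ λs × b ∈ λs × a + a + excess a ≡ L)
    lower-or-upper 1≤a a≤8+m a+b≡L with pairKind 1≤a a≤8+m a+b≡L
    ... | lower a∈λs b∉λs e≡0    = inj₁ (a∈λs , b∉λs , e≡0)
    ... | upper a∉λs b∈λs a+a+e≡L = inj₂ (a∉λs , b∈λs , a+a+e≡L)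
    ... | both  _    _    a+e≡L  = contradiction (excess≤8 1≤a a≤8+m)
      (<⇒≱ (≤-trans (m≤m+n 9 m) (≤-of-+≡ (trans a+e≡L (sym (partners 8 9 refl))) a≤8+m)))

    upper-below⇒⊥ : 1 ≤ a → a ≤ 6 + m → a ≢ d → a + a + excess a ≡ L → ⊥
    upper-below⇒⊥ {a} 1≤a a≤6+m a≢d a+a+e≡L = by-cases (i ≤? 3)
      where
      a≤8+m : a ≤ 8 + m
      a≤8+m = ≤-trans a≤6+m (m≤n+m (6 + m) 2)
      5≤excess : 5 ≤ excess a
      5≤excess = ≤-of-+≡ (trans a+a+e≡L (L≡ m)) (+-mono-≤ a≤6+m a≤6+m)
        where
        L≡ : ∀ m → suc ((8 + m) + (8 + m)) ≡ (6 + m) + (6 + m) + 5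
        L≡ = solve-∀
      by-cases : Dec (i ≤ 3) → ⊥
      by-cases (no i≰3) = 1+n≰n (≤-trans 5≤excess (≤-trans (f≤sumTo (8 + m) 1≤a a≤8+m) E≤4))
        where
        E≤4 : E ≤ 4
        E≤4 = +-cancelʳ-≤ 4 E 4 (≤-trans (+-monoʳ-≤ E (≰⇒> i≰3)) (≤-reflexive E+i≡8))
      by-cases (yes i≤3) = <⇒≱ (s≤s i≤3) (+-cancelʳ-≤ 18 4 i (begin
        22                                        ≡⟨ cong (5 +_) (excess-d d≡i+5+m (+-monoˡ-≤ 5 i≤3)) ⟨
        5 + ((i + 5) + (i + 5) + excess d)        ≡⟨ regroup i (excess d) ⟩
        (i + 5) + (i + 5) + (5 + excess d)        ≤⟨ +-monoʳ-≤ ((i + 5) + (i + 5)) 5+excess-d≤E ⟩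
        (i + 5) + (i + 5) + E                     ≡⟨ regroup′ i E ⟩
        i + 10 + (E + i)                          ≡⟨ cong (i + 10 +_) E+i≡8 ⟩
        i + 10 + 8                                ≡⟨ +-assoc i 10 8 ⟩
        i + 18                                    ∎))
        where
        open ≤-Reasoning
        d≡i+5+m : d ≡ (i + 5) + m
        d≡i+5+m = trans d≡ (sym (+-assoc i 5 m))
        d≤8+m : d ≤ 8 + m
        d≤8+m = subst (_≤ 8 + m) (sym d≡) (+-monoˡ-≤ (5 + m) i≤3)
        5+excess-d≤E : 5 + excess d ≤ E
        5+excess-d≤E = ≤-trans (+-monoˡ-≤ (excess d) 5≤excess) (f+f≤sumTo (8 + m) 1≤a a≤8+m 1≤d d≤8+m a≢d)
        regroup : ∀ i e → 5 + ((i + 5) + (i + 5) + e) ≡ (i + 5) + (i + 5) + (5 + e)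
        regroup = solve-∀
        regroup′ : ∀ i e → (i + 5) + (i + 5) + e ≡ i + 10 + (e + i)
        regroup′ = solve-∀

    lower-below : 1 ≤ a → a ≤ 6 + m → a ≢ d → a + b ≡ L → a ∈ λs × b ∉ λs × excess a ≡ 0
    lower-below 1≤a a≤6+m a≢d a+b≡L with lower-or-upper 1≤a (≤-trans a≤6+m (m≤n+m (6 + m) 2)) a+b≡L
    ... | inj₁ below              = below
    ... | inj₂ (_ , _ , a+a+e≡L) = ⊥-elim (upper-below⇒⊥ 1≤a a≤6+m a≢d a+a+e≡L)

    count-below : d ≤ 6 + m → excess d ≡ c → excess (7 + m) ≡ x → excess (8 + m) ≡ y → c + x + y + i ≡ 8
    count-below d≤6+m refl refl refl =
      subst (λ s → s + excess (7 + m) + excess (8 + m) + i ≡ 8) S₆≡excess-d E+i≡8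
      where
      S₆≡excess-d : sumTo excess (6 + m) ≡ excess d
      S₆≡excess-d = sumTo-point (6 + m) 1≤d d≤6+m λ 1≤a a≤6+m a≢d →
        proj₂ (proj₂ (lower-below 1≤a a≤6+m a≢d (a+[L∸a]≡L (≤-trans a≤6+m (m≤n+m (6 + m) 2)))))

    count-above : 7 + m ≤ d → excess (7 + m) ≡ x → excess (8 + m) ≡ y → x + y + i ≡ 8
    count-above 7+m≤d refl refl =
      subst (λ s → s + excess (7 + m) + excess (8 + m) + i ≡ 8) S₆≡0 E+i≡8
      where
      S₆≡0 : sumTo excess (6 + m) ≡ 0
      S₆≡0 = sumTo-zero (6 + m) λ 1≤a a≤6+m →
        proj₂ (proj₂ (lower-below 1≤a a≤6+m (λ { refl → 1+n≰n (≤-trans 7+m≤d a≤6+m) })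
                                  (a+[L∸a]≡L (≤-trans a≤6+m (m≤n+m (6 + m) 2)))))

    pair₇ : LowerOrUpper (7 + m) (10 + m) 3
    pair₇ = Sum.map₂ (λ (a∉λs , b∈λs , a+a+e≡L) → a∉λs , b∈λs , +-cancelˡ-≡ 14 _ 3 (double 7 a+a+e≡L))
                     (lower-or-upper (s≤s z≤n) (n≤1+n _) (partners 7 10 refl))

    pair₈ : LowerOrUpper (8 + m) (9 + m) 1
    pair₈ = Sum.map₂ (λ (a∉λs , b∈λs , a+a+e≡L) → a∉λs , b∈λs , +-cancelˡ-≡ 16 _ 1 (double 8 a+a+e≡L))
                     (lower-or-upper (s≤s z≤n) ≤-refl (partners 8 9 refl))

  pairs-at-5+m : (∀ {x y} → excess (7 + m) ≡ x → excess (8 + m) ≡ y → 7 + x + y + 0 ≡ 8) →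
                 LowerOrUpper (7 + m) (10 + m) 3 → LowerOrUpper (8 + m) (9 + m) 1 →
                 7 + m ∈ λs × 10 + m ∉ λs × 8 + m ∉ λs × 9 + m ∈ λs
  pairs-at-5+m _     (inj₁ (7+m∈ , 10+m∉ , _)) (inj₂ (8+m∉ , 9+m∈ , _)) = 7+m∈ , 10+m∉ , 8+m∉ , 9+m∈
  pairs-at-5+m count (inj₁ (_ , _ , e₇))       (inj₁ (_ , _ , e₈))     = contradiction (count e₇ e₈) λ ()
  pairs-at-5+m count (inj₂ (_ , _ , e₇))       (inj₁ (_ , _ , e₈))     = contradiction (count e₇ e₈) λ ()
  pairs-at-5+m count (inj₂ (_ , _ , e₇))       (inj₂ (_ , _ , e₈))     = contradiction (count e₇ e₈) λ ()

  pairs-at-6+m : (∀ {x y} → excess (7 + m) ≡ x → excess (8 + m) ≡ y → 5 + x + y + 1 ≡ 8) →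
                 LowerOrUpper (7 + m) (10 + m) 3 → LowerOrUpper (8 + m) (9 + m) 1 → ⊥
  pairs-at-6+m count (inj₁ (_ , _ , e₇)) (inj₁ (_ , _ , e₈)) = contradiction (count e₇ e₈) λ ()
  pairs-at-6+m count (inj₁ (_ , _ , e₇)) (inj₂ (_ , _ , e₈)) = contradiction (count e₇ e₈) λ ()
  pairs-at-6+m count (inj₂ (_ , _ , e₇)) (inj₁ (_ , _ , e₈)) = contradiction (count e₇ e₈) λ ()
  pairs-at-6+m count (inj₂ (_ , _ , e₇)) (inj₂ (_ , _ , e₈)) = contradiction (count e₇ e₈) λ ()

  pairs-above-6+m : ∀ j → d ≡ 2 + j + (5 + m) →
                    (∀ {x y} → excess (7 + m) ≡ x → excess (8 + m) ≡ y → x + y + (2 + j) ≡ 8) →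
                    LowerOrUpper (7 + m) (10 + m) 3 → LowerOrUpper (8 + m) (9 + m) 1 → ⊥
  pairs-above-6+m j d≡ count (inj₁ (_ , _ , e₇)) (inj₁ (_ , _ , e₈)) with refl ← count e₇ e₈ =
    d≢11+m+ 2 d≡
  pairs-above-6+m j d≡ count (inj₁ (_ , _ , e₇)) (inj₂ (_ , _ , e₈)) with refl ← count e₇ e₈ =
    d≢11+m+ 1 d≡
  pairs-above-6+m j d≡ count (inj₂ (_ , 10+m∈ , e₇)) (inj₁ (_ , _ , e₈)) with refl ← count e₇ e₈ =
    d∉λs (subst (_∈ λs) (sym d≡) 10+m∈)
  pairs-above-6+m j d≡ count (inj₂ (_ , _ , e₇)) (inj₂ (_ , 9+m∈ , e₈)) with refl ← count e₇ e₈ =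
    d∉λs (subst (_∈ λs) (sym d≡) 9+m∈)

  classify : ∀ i → d ≡ i + (5 + m) → d ≡ 5 + m × Shape m λs
  classify zero d≡ = d≡ , record
    { lower-pairs = λ 1≤a a≤6+m a≢5+m a+b≡L →
        let a∈λs , b∉λs , _ = G.lower-below 1≤a a≤6+m (λ a≡d → a≢5+m (trans a≡d d≡)) a+b≡L in a∈λs , b∉λs
    ; 5+m∉  = subst (_∉ λs) d≡ d∉λs
    ; 12+m∈ = proj₁ (missing⇒upper 1≤d (subst (_≤ 8 + m) (sym d≡) (m≤n+m (5 + m) 3))
                                       (subst (λ d → d + (12 + m) ≡ L) (sym d≡) (partners 5 12 refl)) d∉λs)
    ; 7+m∈  = proj₁ pairs
    ; 10+m∉ = proj₁ (proj₂ pairs)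
    ; 8+m∉  = proj₁ (proj₂ (proj₂ pairs))
    ; 9+m∈  = proj₂ (proj₂ (proj₂ pairs))
    }
    where
    module G = AtOffset 0 d≡
    pairs = pairs-at-5+m (G.count-below (subst (_≤ 6 + m) (sym d≡) (n≤1+n _))
                                        (+-cancelˡ-≡ 10 _ 7 (excess-d d≡ (m≤m+n 5 3))))
                         G.pair₇ G.pair₈
  classify (suc zero) d≡ =
    ⊥-elim (pairs-at-6+m (G.count-below (subst (_≤ 6 + m) (sym d≡) ≤-refl)
                                        (+-cancelˡ-≡ 12 _ 5 (excess-d d≡ (m≤m+n 6 2))))
                         G.pair₇ G.pair₈)
    where module G = AtOffset 1 d≡
  classify (suc (suc j)) d≡ =
    ⊥-elim (pairs-above-6+m j d≡ (G.count-above (subst (7 + m ≤_) (sym d≡) (s≤s (s≤s (m≤n+m (5 + m) j)))))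
                            G.pair₇ G.pair₈)
    where module G = AtOffset (suc (suc j)) d≡

  result : d ≡ 5 + m × Shape m λs
  result = uncurry classify d-decomposition

classification : ∀ {m d xs} → 1 ≤ d → d ≤ 10 + m → IsMaxUnrefinable (T (11 + m) d) xs → d ∉ xs →
                 largestPart xs ≡ 2 * (11 + m) ∸ 5 → d ≡ 5 + m × Shape m xs
classification {m} 1≤d d≤10+m xs∈𝕌* d∉xs xs-largest =
  Analysis.result xs∈𝕌* (trans xs-largest (2*[11+m]∸5 m)) d∉xs 1≤d d≤10+m

proposition2p13 : (n d : ℕ) → 11 ≤ n → 1 ≤ d → d ≤ n ∸ 1 →
    (λs : List ℕ) → IsMaxUnrefinable (T n d) λs → d ∉ λs →
    largestPart λs ≡ 2 * n ∸ 5 →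
    d ≡ n ∸ 6 ×
    ((μ : List ℕ) → IsMaxUnrefinable (T n d) μ → d ∉ μ →
      largestPart μ ≡ 2 * n ∸ 5 → μ ≡ λs)
proposition2p13 n d 11≤n with m , refl ← m≤n⇒∃[o]m+o≡n 11≤n = λ 1≤d d≤10+m λs λs∈𝕌* d∉λs λs-largest →
  let d≡5+m , λs-shape = classification 1≤d d≤10+m λs∈𝕌* d∉λs λs-largest
  in d≡5+m , λ μ μ∈𝕌* d∉μ μ-largest →
       Shape-unique (proj₁ μ∈𝕌*) (trans μ-largest (2*[11+m]∸5 m))
                    (proj₂ (classification 1≤d d≤10+m μ∈𝕌* d∉μ μ-largest))
                    (proj₁ λs∈𝕌*) (trans λs-largest (2*[11+m]∸5 m)) λs-shape
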